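{- Let $k \geq 1$ and $n \geq 1$ be integers, and let $a$ be an integer with $a \geq 2^{n-1}$. Then $a \cdot c_k(n)$ is the sum of at most $\left\lceil \frac{a}{2^n-1} \right\rceil$ binary $k$'th powers.
   Context: $c_k(n) := \frac{2^{kn}-1}{2^n-1} = 1 + 2^n + \cdots + 2^{(k-1)n}$. A natural number is a binary $k$'th power if its canonical binary representation (no leading zeros) consists of $k$ consecutive identical blocks; equivalently, it is $0$ or of the form $a' \cdot c_k(m)$ with $m \geq 1$ and $2^{m-1} \leq a' < 2^m$. Sums may repeat terms. -}

module Defs where

open import Data.Nat using (ℕ; zero; suc; _+_; _*_; _∸_; _^_; _≤_; _<_)
open import Data.Nat.DivMod using (_/_)
open import Data.List using (List; length)
open import Data.Nat.ListAction using (sum)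
open import Data.List.Relation.Unary.All using (All)
open import Data.Product using (Σ; _×_; ∃)
open import Data.Sum using (_⊎_)
open import Relation.Binary.PropositionalEquality using (_≡_)

-- c k n = 1 + 2^n + ... + 2^((k-1) n)
c : ℕ → ℕ → ℕ
c zero    n = 0
c (suc k) n = 1 + (2 ^ n) * c k n

-- ceiling division ⌈ a / d ⌉ for d ≥ 1 (defined as 0 for d = 0; never used)
ceilDiv : ℕ → ℕ → ℕ
ceilDiv a zero    = 0
ceilDiv a (suc d) = (a + d) / suc d

BinPow : ℕ → ℕ → Set
BinPow k x = (x ≡ 0) ⊎
  (Σ ℕ λ m → Σ ℕ λ a' → 1 ≤ m × 2 ^ (m ∸ 1) ≤ a' × a' < 2 ^ m × x ≡ a' * c k m)

SumOfAtMost : ℕ → ℕ → ℕ → Set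
SumOfAtMost k N x = Σ (List ℕ) λ xs → length xs ≤ N × All (BinPow k) xs × sum xs ≡ x

{-# OPTIONS --safe #-}
module Submission where

open import Defs
open import Data.Nat using (ℕ; suc; _+_; _*_; _∸_; _^_; _≤_; _<_; z≤n; s≤s; s≤s⁻¹; _≤?_)
open import Data.Nat.Properties
open import Data.Nat.DivMod using (m*n/n≡m; /-monoˡ-≤)
open import Data.Nat.Induction using (<-rec)
open import Data.List using ([]; _∷_; [_]; length; map)
open import Data.List.Properties using (length-map)
open import Data.Nat.ListAction using (sum)
open import Data.List.Relation.Unary.All as All using (All; []; _∷_)
open import Data.List.Relation.Unary.All.Properties using (map⁺)
open import Data.Product using (_×_; _,_; ∃)
open import Data.Sum using (inj₂)
open import Relation.Nullary using (yes; no; contradiction)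
open import Relation.Binary.PropositionalEquality using (_≡_; refl; sym; trans; cong)

-- Every a ≥ h is a sum of parts from the interval [h, D], where 2h ≤ D + 1, using at
-- most ⌈a / D⌉ parts: greedily split off parts D while the remainder stays ≥ h; a final
-- remainder r < h is absorbed by replacing the last D + r with h + (D + r − h).
-- With h = 2^(n−1) and D = 2^n − 1 the parts x are exactly the n-bit numbers, and
-- x · c k n is the binary k'th power with block x.

_∈[_,_] : ℕ → ℕ → ℕ → Set
x ∈[ h , D ] = h ≤ x × x ≤ D

m+m≤1+n⇒m≤n : ∀ {m n} → 1 ≤ m → m + m ≤ suc n → m ≤ n
m+m≤1+n⇒m≤n {m} 1≤m m+m≤1+n =
  s≤s⁻¹ (≤-trans (≤-reflexive (+-comm 1 m)) (≤-trans (+-monoʳ-≤ m 1≤m) m+m≤1+n))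

m*[1+d]≤o+d⇒m≤⌈o/[1+d]⌉ : ∀ m o d → m * suc d ≤ o + d → m ≤ ceilDiv o (suc d)
m*[1+d]≤o+d⇒m≤⌈o/[1+d]⌉ m o d le =
  ≤-trans (≤-reflexive (sym (m*n/n≡m m (suc d)))) (/-monoˡ-≤ (suc d) le)

IntervalSplit : ℕ → ℕ → ℕ → Set
IntervalSplit h d a = ∃ λ xs → All (_∈[ h , suc d ]) xs × sum xs ≡ a × length xs * suc d ≤ a + d

split-into-interval : ∀ {h d} → 1 ≤ h → h + h ≤ suc (suc d) →
  ∀ a → h ≤ a → IntervalSplit h d a
split-into-interval {h} {d} 1≤h 2h≤D+1 = <-rec (λ a → h ≤ a → IntervalSplit h d a) step
  where
  D = suc d
  h≤D = m+m≤1+n⇒m≤n 1≤h 2h≤D+1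

  step : ∀ a → (∀ {r} → r < a → h ≤ r → IntervalSplit h d r) → h ≤ a → IntervalSplit h d a
  step a rec h≤a with a ≤? D
  ... | yes a≤D = [ a ] , (h≤a , a≤D) ∷ [] , +-identityʳ a , one-part
    where
    one-part : 1 * D ≤ a + d
    one-part = ≤-trans (≤-reflexive (*-identityˡ D)) (+-monoˡ-≤ d (≤-trans 1≤h h≤a))
  ... | no a≰D with h ≤? a ∸ D
  ...   | yes h≤r with rec (∸-monoʳ-< {o = 0} (s≤s z≤n) D≤a) h≤r
    where
    D≤a = <⇒≤ (≰⇒> a≰D)
  ...     | xs , parts , sum≡ , len = D ∷ xs , (h≤D , ≤-refl) ∷ parts , peel-sum , peel-len
    where
    D+[a∸D]≡a = m+[n∸m]≡n (<⇒≤ (≰⇒> a≰D))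

    peel-sum : D + sum xs ≡ a
    peel-sum = trans (cong (D +_) sum≡) D+[a∸D]≡a

    peel-len : D + length xs * D ≤ a + d
    peel-len = begin
      D + length xs * D  ≤⟨ +-monoʳ-≤ D len ⟩
      D + (a ∸ D + d)    ≡⟨ sym (+-assoc D (a ∸ D) d) ⟩
      D + (a ∸ D) + d    ≡⟨ cong (_+ d) D+[a∸D]≡a ⟩
      a + d              ∎
      where open ≤-Reasoning
  step a rec h≤a | no a≰D | no h≰r =
    h ∷ a ∸ h ∷ [] , (≤-refl , h≤D) ∷ (h≤a∸h , a∸h≤D) ∷ [] , two-sum , two-len
    where
    D<a : D < a
    D<a = ≰⇒> a≰D

    h≤a∸h : h ≤ a ∸ h
    h≤a∸h = ≤-trans (≤-reflexive (sym (m+n∸n≡m h h))) (∸-monoˡ-≤ h (≤-trans 2h≤D+1 D<a))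

    a<h+D : a < h + D
    a<h+D = begin-strict
      a            ≡⟨ sym (m+[n∸m]≡n (<⇒≤ D<a)) ⟩
      D + (a ∸ D)  <⟨ +-monoʳ-< D (≰⇒> h≰r) ⟩
      D + h        ≡⟨ +-comm D h ⟩
      h + D        ∎
      where open ≤-Reasoning

    a∸h≤D : a ∸ h ≤ D
    a∸h≤D = <⇒≤ (m<n+o⇒m∸n<o a h a<h+D)

    two-sum : h + (a ∸ h + 0) ≡ a
    two-sum = trans (cong (h +_) (+-identityʳ (a ∸ h))) (m+[n∸m]≡n h≤a)

    two-len : 2 * D ≤ a + d
    two-len = begin
      2 * D           ≡⟨ cong suc (trans (cong (d +_) (+-identityʳ D)) (+-suc d d)) ⟩
      suc D + d       ≤⟨ +-monoˡ-≤ d D<a ⟩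
      a + d           ∎
      where open ≤-Reasoning

sum-of-interval-parts : ∀ {h D} → 1 ≤ h → h + h ≤ suc D → ∀ {a} → h ≤ a →
  ∃ λ xs → length xs ≤ ceilDiv a D × All (_∈[ h , D ]) xs × sum xs ≡ a
sum-of-interval-parts {D = 0}     1≤h 2h≤D+1 h≤a =
  contradiction (m+m≤1+n⇒m≤n 1≤h 2h≤D+1) (<⇒≱ 1≤h)
sum-of-interval-parts {D = suc d} 1≤h 2h≤D+1 {a} h≤a
  with xs , parts , sum≡ , len ← split-into-interval 1≤h 2h≤D+1 a h≤a
  = xs , m*[1+d]≤o+d⇒m≤⌈o/[1+d]⌉ (length xs) a d len , parts , sum≡

binPow-*c : ∀ k {n x} → 1 ≤ n → x ∈[ 2 ^ (n ∸ 1) , 2 ^ n ∸ 1 ] → BinPow k (x * c k n)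
binPow-*c k {n} {x} 1≤n (lo , hi) = inj₂ (n , x , 1≤n , lo , x<2^n , refl)
  where
  x<2^n : x < 2 ^ n
  x<2^n = ≤-trans (s≤s hi) (≤-reflexive (m+[n∸m]≡n (m^n>0 2 n)))

sum-map-*ʳ : ∀ m xs → sum (map (_* m) xs) ≡ sum xs * m
sum-map-*ʳ m []       = refl
sum-map-*ʳ m (x ∷ xs) = trans (cong (x * m +_) (sum-map-*ʳ m xs)) (sym (*-distribʳ-+ m x (sum xs)))

double-half-power : ∀ n → 1 ≤ n → 2 ^ (n ∸ 1) + 2 ^ (n ∸ 1) ≤ suc (2 ^ n ∸ 1)
double-half-power (suc n) _ =
  ≤-trans (≤-reflexive (cong (2 ^ n +_) (sym (+-identityʳ (2 ^ n))))) (m≤n+m∸n (2 ^ suc n) 1)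

lemma7 : (k n a : ℕ) → 1 ≤ k → 1 ≤ n → 2 ^ (n ∸ 1) ≤ a →
    SumOfAtMost k (ceilDiv a (2 ^ n ∸ 1)) (a * c k n)
lemma7 k n a _ 1≤n h≤a
  with xs , len , parts , sum≡ ← sum-of-interval-parts (m^n>0 2 (n ∸ 1)) (double-half-power n 1≤n) h≤a
  = map (_* c k n) xs
  , ≤-trans (≤-reflexive (length-map (_* c k n) xs)) len
  , map⁺ (All.map (binPow-*c k 1≤n) parts)
  , trans (sum-map-*ʳ (c k n) xs) (cong (_* c k n) sum≡)
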